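{- Let $a$ and $b$ be positive integers. Then $$\lim_{n \to \infty} H\!\left(\frac{a}{b}\,n! + 1\right) = 1 \quad\text{and}\quad \lim_{n \to \infty} H\!\left(\frac{a}{b}\,n! - 1\right) = 1.$$
   Context: For a positive integer $m$, $H(m)=\prod_{p\mid m} \frac{p}{p-1}$, the product over the distinct primes dividing $m$ (so $H(1)=1$). For all sufficiently large $n$, $\frac{a}{b}n!\pm 1$ is a positive integer, and the limits are taken over such $n$. -}

module Defs where

open import Data.Nat using (ℕ; zero; suc)
open import Data.Nat.Divisibility using (_∣?_)
open import Data.Nat.Primality using (prime?)
open import Data.Bool using (if_then_else_; _∧_)
open import Data.Integer using (+_)
open import Data.Rational using (ℚ; 1ℚ; _/_; _*_)
open import Relation.Nullary using (does)

-- the factor p/(p-1) (only used for primes p ≥ 2; set to 1 for p < 2)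
ratio : ℕ → ℚ
ratio (suc (suc k)) = (+ suc (suc k)) / suc k
ratio _ = 1ℚ

Hupto : ℕ → ℕ → ℚ
Hupto m zero = 1ℚ
Hupto m (suc k) =
  Hupto m k * (if does (prime? (suc k)) ∧ does (suc k ∣? m) then ratio (suc k) else 1ℚ)

-- H(m) = ∏_{p ∣ m, p prime} p/(p-1); every prime divisor of m ≥ 1 is ≤ m
H : ℕ → ℚ
H m = Hupto m m

{-# OPTIONS --safe #-}
-- Put M = a·n!/b: once 2b ≤ n,
-- every prime p ≤ n divides M, so m = M ± 1 has no prime factor ≤ n, while m ≤ (n + 1)^(n + 1).
-- Group the prime factors of m into the dyadic blocks (x, 2x] for x = n, 2n, …, 2^(J-1) n and
-- the rest, which exceed X = 2^J n. The primes of a block divide the central binomial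
-- coefficient C(2x, x) ≤ 4^x, so if 16^s ≤ n + 1 there are at most c ≤ x/(2s) of them and the
-- block contributes at most (1 + 1/x)^c ≤ 1 + 2c/x ≤ 1 + 1/s; all J blocks together give at most
-- (1 + 1/s)^J ≤ 1 + 2J/s. At most n + 1 primes exceed X, since their product is at most m, so
-- they contribute at most 1 + 2(n + 1)/X = 1 + O(2^-J). Choosing J, then s, then n large makes
-- H(m) arbitrarily close to 1.
module Submission where

module PrimeDivisorBounds where

  open import Data.Nat
  open import Data.Nat.Properties
  open import Data.Nat.Divisibility
  open import Data.Nat.Primality
  open import Data.Nat.Combinatorics using (_C_; nCk+nC[k+1]≡[n+1]C[k+1]; nCk≡n!/k![n-k]!; k![n∸k]!∣n!)
  open import Data.Nat.DivMod using (_/_; m/n*n≡m; m/n≤m)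
  open import Data.Nat.ListAction using (product)
  open import Data.Nat.ListAction.Properties using (product-++)
  open import Data.List using (List; []; _∷_; _++_; map; length; filter)
  open import Data.List.Properties using (map-++; filter-++; filter-none)
  open import Data.List.Relation.Unary.All as All using (All; []; _∷_)
  open import Data.List.Relation.Unary.All.Properties using (all-filter) renaming (filter⁺ to All-filter⁺)
  open import Data.List.Relation.Unary.AllPairs using (AllPairs; []; _∷_)
  open import Data.List.Relation.Unary.AllPairs.Properties using () renaming (filter⁺ to AllPairs-filter⁺)
  open import Data.Product using (_×_; _,_; ∃; proj₁; proj₂)
  import Data.Product as Product
  open import Data.Sum using (inj₁; inj₂)
  open import Relation.Nullary using (¬_; contradiction; yes; no)
  open import Relation.Nullary.Decidable using (_×-dec_)
  open import Relation.Unary using (Decidable)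
  open import Function using (_∘_)
  open import Relation.Binary.PropositionalEquality
    using (_≡_; refl; sym; trans; cong; cong₂; subst; subst₂; module ≡-Reasoning)
  open import Algebra.Properties.CommutativeSemigroup *-commutativeSemigroup
    using (interchange; xy∙z≈xz∙y; x∙yz≈xz∙y; x∙yz≈y∙xz; x∙yz≈yx∙z)
  open import Data.Nat.Tactic.RingSolver using (solve-∀)

  infix  5 _÷_
  infixl 4.5 _*ʳ_
  infix  4 _≤ʳ_ _<ʳ_

  record Ratio : Set where
    constructor _÷_
    field
      numerator denominator : ℕ

  _*ʳ_ : Ratio → Ratio → Ratio
  (p ÷ d) *ʳ (q ÷ e) = p * q ÷ d * e

  data _≤ʳ_ : Ratio → Ratio → Set where
    *≤* : ∀ {p d q e} → p * e ≤ d * q → p ÷ d ≤ʳ q ÷ e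

  data _<ʳ_ : Ratio → Ratio → Set where
    *<* : ∀ {p d q e} → p * e < d * q → p ÷ d <ʳ q ÷ e

  drop-*≤* : ∀ {p d q e} → p ÷ d ≤ʳ q ÷ e → p * e ≤ d * q
  drop-*≤* (*≤* pe≤dq) = pe≤dq

  *ʳ-mono-≤ʳ : ∀ {r s r′ s′} → r ≤ʳ s → r′ ≤ʳ s′ → r *ʳ r′ ≤ʳ s *ʳ s′
  *ʳ-mono-≤ʳ (*≤* {p} {d} {q} {e} pe≤dq) (*≤* {p′} {d′} {q′} {e′} pe≤dq′) = *≤* (begin
    p * p′ * (e * e′) ≡⟨ interchange p p′ e e′ ⟩
    p * e * (p′ * e′) ≤⟨ *-mono-≤ pe≤dq pe≤dq′ ⟩
    d * q * (d′ * q′) ≡⟨ interchange d q d′ q′ ⟩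
    d * d′ * (q * q′) ∎)
    where open ≤-Reasoning

  ≤ʳ-trans : ∀ {r q e s} .{{_ : NonZero e}} → r ≤ʳ q ÷ e → q ÷ e ≤ʳ s → r ≤ʳ s
  ≤ʳ-trans {e = e} (*≤* {p} {d} {q} pe≤dq) (*≤* {q = a} {b} qb≤ea) =
    *≤* (*-cancelʳ-≤ (p * b) (d * a) e (begin
      p * b * e   ≡⟨ xy∙z≈xz∙y p b e ⟩
      p * e * b   ≤⟨ *-monoˡ-≤ b pe≤dq ⟩
      d * q * b   ≡⟨ *-assoc d q b ⟩
      d * (q * b) ≤⟨ *-monoʳ-≤ d qb≤ea ⟩
      d * (e * a) ≡⟨ x∙yz≈xz∙y d e a ⟩
      d * a * e   ∎))
    where open ≤-Reasoning

  ≤ʳ-<ʳ-trans : ∀ {p d q e s} .{{_ : NonZero d}} .{{_ : NonZero e}} →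
                p ÷ d ≤ʳ q ÷ e → q ÷ e <ʳ s → p ÷ d <ʳ s
  ≤ʳ-<ʳ-trans {p} {d} {q} {e} (*≤* pe≤dq) (*<* {q = a} {b} qb<ea) =
    *<* (*-cancelʳ-< e (p * b) (d * a) (begin-strict
      p * b * e   ≡⟨ xy∙z≈xz∙y p b e ⟩
      p * e * b   ≤⟨ *-monoˡ-≤ b pe≤dq ⟩
      d * q * b   ≡⟨ *-assoc d q b ⟩
      d * (q * b) <⟨ *-monoʳ-< d qb<ea ⟩
      d * (e * a) ≡⟨ x∙yz≈xz∙y d e a ⟩
      d * a * e   ∎))
    where open ≤-Reasoning

  [x+a]/x≤[1+w]/w : ∀ {x a w} → a * w ≤ x → x + a ÷ x ≤ʳ suc w ÷ w
  [x+a]/x≤[1+w]/w {x} {a} {w} aw≤x = *≤* (begin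
    (x + a) * w   ≡⟨ *-distribʳ-+ w x a ⟩
    x * w + a * w ≤⟨ +-monoʳ-≤ (x * w) aw≤x ⟩
    x * w + x     ≡⟨ +-comm (x * w) x ⟩
    x + x * w     ≡⟨ *-suc x w ⟨
    x * suc w     ∎)
    where open ≤-Reasoning

  [1+1/x]^c≤1+2c/x : ∀ x c → 2 * c ≤ x → suc x ^ c ÷ x ^ c ≤ʳ x + 2 * c ÷ x
  [1+1/x]^c≤1+2c/x x zero    _      = *≤* (≤-reflexive (sym (+-identityʳ (x + 0))))
  [1+1/x]^c≤1+2c/x x (suc c) 2c+2≤x = *≤* (begin
    suc x * suc x ^ c * x         ≡⟨ *-assoc (suc x) (suc x ^ c) x ⟩
    suc x * (suc x ^ c * x)       ≤⟨ *-monoʳ-≤ (suc x) (drop-*≤* ([1+1/x]^c≤1+2c/x x c 2c≤x)) ⟩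
    suc x * (x ^ c * (x + 2 * c)) ≡⟨ x∙yz≈y∙xz (suc x) (x ^ c) (x + 2 * c) ⟩
    x ^ c * (suc x * (x + 2 * c)) ≤⟨ *-monoʳ-≤ (x ^ c) step ⟩
    x ^ c * (x * (x + 2 * suc c)) ≡⟨ x∙yz≈yx∙z (x ^ c) x (x + 2 * suc c) ⟩
    x * x ^ c * (x + 2 * suc c)   ∎)
    where
    open ≤-Reasoning
    2c≤x : 2 * c ≤ x
    2c≤x = ≤-trans (*-monoʳ-≤ 2 (n≤1+n c)) 2c+2≤x
    expand : ∀ x c → x * (x + 2 * suc c) ≡ x * (x + 2 * c) + (x + x)
    expand = solve-∀
    step : suc x * (x + 2 * c) ≤ x * (x + 2 * suc c)
    step = begin
      suc x * (x + 2 * c)           ≡⟨ +-comm (x + 2 * c) _ ⟩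
      x * (x + 2 * c) + (x + 2 * c) ≤⟨ +-monoʳ-≤ (x * (x + 2 * c)) (+-monoʳ-≤ x 2c≤x) ⟩
      x * (x + 2 * c) + (x + x)     ≡⟨ expand x c ⟨
      x * (x + 2 * suc c)           ∎

  Hʳ : List ℕ → Ratio
  Hʳ ps = product ps ÷ product (map pred ps)

  Hʳ-++ : ∀ ps qs → Hʳ (ps ++ qs) ≡ Hʳ ps *ʳ Hʳ qs
  Hʳ-++ ps qs = cong₂ _÷_ (product-++ ps qs)
    (trans (cong product (map-++ pred ps qs)) (product-++ (map pred ps) (map pred qs)))

  p/[p-1]≤[x+1]/x : ∀ {x p} → x < p → p ÷ pred p ≤ʳ suc x ÷ x
  p/[p-1]≤[x+1]/x {x} {suc q} (s≤s x≤q) = *≤* (begin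
    x + q * x ≤⟨ +-monoˡ-≤ (q * x) x≤q ⟩
    q + q * x ≡⟨ *-suc q x ⟨
    q * suc x ∎)
    where open ≤-Reasoning

  Hʳ≤[1+1/x]^length : ∀ {x ps} → All (x <_) ps → Hʳ ps ≤ʳ suc x ^ length ps ÷ x ^ length ps
  Hʳ≤[1+1/x]^length []           = *≤* ≤-refl
  Hʳ≤[1+1/x]^length (x<p ∷ x<ps) = *ʳ-mono-≤ʳ (p/[p-1]≤[x+1]/x x<p) (Hʳ≤[1+1/x]^length x<ps)

  Hʳ≤1+2length/x : ∀ {x ps} .{{_ : NonZero x}} → All (x <_) ps → 2 * length ps ≤ x →
                   Hʳ ps ≤ʳ x + 2 * length ps ÷ x
  Hʳ≤1+2length/x {x} {ps} x<ps 2c≤x = ≤ʳ-trans {{m^n≢0 x (length ps)}}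
    (Hʳ≤[1+1/x]^length x<ps) ([1+1/x]^c≤1+2c/x x (length ps) 2c≤x)

  [1+x]^length≤product : ∀ {x ps} → All (x <_) ps → suc x ^ length ps ≤ product ps
  [1+x]^length≤product []           = ≤-refl
  [1+x]^length≤product (x<p ∷ x<ps) = *-mono-≤ x<p ([1+x]^length≤product x<ps)

  prime⇒pred≢0 : ∀ {p} → Prime p → NonZero (pred p)
  prime⇒pred≢0 {suc (suc _)} _ = _

  Hʳ-denominator≢0 : ∀ {ps} → All Prime ps → NonZero (product (map pred ps))
  Hʳ-denominator≢0 []          = _
  Hʳ-denominator≢0 (pp ∷ pps) = m*n≢0 _ _ {{prime⇒pred≢0 pp}} {{Hʳ-denominator≢0 pps}}

  Hʳ-denominator≤numerator : ∀ ps → product (map pred ps) ≤ product ps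
  Hʳ-denominator≤numerator []       = ≤-refl
  Hʳ-denominator≤numerator (p ∷ ps) = *-mono-≤ (pred[n]≤n {p}) (Hʳ-denominator≤numerator ps)

  prime∤1 : ∀ {p} → Prime p → p ∤ 1
  prime∤1 pp p∣1 = ¬prime[1] (subst Prime (∣1⇒≡1 p∣1) pp)

  prime∤product : ∀ {p qs} → Prime p → All Prime qs → All (_< p) qs → p ∤ product qs
  prime∤product pp []          []          = prime∤1 pp
  prime∤product pp (qp ∷ qps) (q<p ∷ qs<p) p∣q*qs with euclidsLemma _ _ pp p∣q*qs
  ... | inj₁ p∣q  = <⇒≱ q<p (∣⇒≤ {{prime⇒nonZero qp}} p∣q)
  ... | inj₂ p∣qs = prime∤product pp qps qs<p p∣qs

  p∣n∧m∣n∧p∤m⇒p*m∣n : ∀ {p m n} → Prime p → p ∣ n → m ∣ n → p ∤ m → p * m ∣ n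
  p∣n∧m∣n∧p∤m⇒p*m∣n {p} {m} pp p∣qm (divides q refl) p∤m with euclidsLemma q m pp p∣qm
  ... | inj₁ (divides r refl) = divides r (*-assoc r p m)
  ... | inj₂ p∣m              = contradiction p∣m p∤m

  product∣ : ∀ {ps n} → AllPairs _>_ ps → All Prime ps → All (_∣ n) ps → product ps ∣ n
  product∣ {n = n} []                  []          []          = 1∣ n
  product∣ (p>ps ∷ decreasing) (pp ∷ pps) (p∣n ∷ ps∣n) =
    p∣n∧m∣n∧p∤m⇒p*m∣n pp p∣n (product∣ decreasing pps ps∣n) (prime∤product pp pps p>ps)

  nCk≤2^n : ∀ n k → n C k ≤ 2 ^ n
  nCk≤2^n zero    zero    = ≤-refl
  nCk≤2^n zero    (suc k) = z≤n
  nCk≤2^n (suc n) zero    = m^n>0 2 (suc n)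
  nCk≤2^n (suc n) (suc k) = begin
    suc n C suc k       ≡⟨ nCk+nC[k+1]≡[n+1]C[k+1] n k ⟨
    n C k + n C suc k   ≤⟨ +-mono-≤ (nCk≤2^n n k) (nCk≤2^n n (suc k)) ⟩
    2 ^ n + 2 ^ n       ≡⟨ cong (2 ^ n +_) (+-identityʳ (2 ^ n)) ⟨
    2 ^ suc n           ∎
    where open ≤-Reasoning

  nCk*k![n∸k]!≡n! : ∀ {n k} → k ≤ n → (n C k) * (k ! * (n ∸ k) !) ≡ n !
  nCk*k![n∸k]!≡n! {n} {k} k≤n = trans (cong (_* (k ! * (n ∸ k) !)) (nCk≡n!/k![n-k]! k≤n))
    (m/n*n≡m {{k !* (n ∸ k) !≢0}} (k![n∸k]!∣n! k≤n))

  m≤n⇒m∣n! : ∀ {m n} .{{_ : NonZero m}} → m ≤ n → m ∣ n !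
  m≤n⇒m∣n! {suc m} m≤n = ∣-trans (m∣m*n (m !)) (m≤n⇒m!∣n! m≤n)

  prime∣n!⇒p≤n : ∀ {p} n → Prime p → p ∣ n ! → p ≤ n
  prime∣n!⇒p≤n zero    pp p∣1     = contradiction p∣1 (prime∤1 pp)
  prime∣n!⇒p≤n (suc n) pp p∣n*n! with euclidsLemma (suc n) (n !) pp p∣n*n!
  ... | inj₁ p∣1+n = ∣⇒≤ p∣1+n
  ... | inj₂ p∣n!  = m≤n⇒m≤1+n (prime∣n!⇒p≤n n pp p∣n!)

  prime∣[2x]Cx : ∀ {p x} → Prime p → x < p → p ≤ x + x → p ∣ (x + x) C x
  prime∣[2x]Cx {p} {x} pp x<p p≤2x
    with euclidsLemma ((x + x) C x) (x ! * (x + x ∸ x) !) pp p∣C*x!x!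
    where
    p∣C*x!x! : p ∣ ((x + x) C x) * (x ! * (x + x ∸ x) !)
    p∣C*x!x! = subst (p ∣_) (sym (nCk*k![n∸k]!≡n! (m≤m+n x x)))
      (m≤n⇒m∣n! {{prime⇒nonZero pp}} p≤2x)
  ... | inj₁ p∣C     = p∣C
  ... | inj₂ p∣x!x! with euclidsLemma (x !) _ pp p∣x!x!
  ...   | inj₁ p∣x! = contradiction (prime∣n!⇒p≤n x pp p∣x!) (<⇒≱ x<p)
  ...   | inj₂ p∣x!′ = contradiction (prime∣n!⇒p≤n _ pp p∣x!′)
                                    (subst (λ y → ¬ p ≤ y) (sym (m+n∸n≡m x x)) (<⇒≱ x<p))

  nCk≢0 : ∀ {n k} → k ≤ n → NonZero (n C k)
  nCk≢0 {n} {k} k≤n = m*n≢0⇒m≢0 (n C k) {{subst NonZero (sym (nCk*k![n∸k]!≡n! k≤n)) (n !≢0)}}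

  PrimeDivisor : ℕ → ℕ → Set
  PrimeDivisor m p = Prime p × p ∣ m

  primeDivisor? : ∀ m → Decidable (PrimeDivisor m)
  primeDivisor? m p = prime? p ×-dec p ∣? m

  interval : ℕ → ℕ → List ℕ
  interval lo zero    = []
  interval lo (suc d) = suc (lo + d) ∷ interval lo d

  interval-bounds : ∀ lo d → All (λ k → lo < k × k ≤ lo + d) (interval lo d)
  interval-bounds lo zero    = []
  interval-bounds lo (suc d) =
    (s≤s (m≤m+n lo d) , ≤-reflexive (sym (+-suc lo d)))
    ∷ All.map (λ (lo<k , k≤lo+d) → lo<k , ≤-trans k≤lo+d (+-monoʳ-≤ lo (n≤1+n d)))
              (interval-bounds lo d)

  interval-decreasing : ∀ lo d → AllPairs _>_ (interval lo d)
  interval-decreasing lo zero    = []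
  interval-decreasing lo (suc d) =
    All.map (λ (_ , k≤lo+d) → s≤s k≤lo+d) (interval-bounds lo d) ∷ interval-decreasing lo d

  interval-++ : ∀ lo d e → interval lo (e + d) ≡ interval (lo + d) e ++ interval lo d
  interval-++ lo d zero    = refl
  interval-++ lo d (suc e) =
    cong₂ _∷_ (cong suc (trans (cong (lo +_) (+-comm e d)) (sym (+-assoc lo d e)))) (interval-++ lo d e)

  primeDivisorsIn : ℕ → ℕ → ℕ → List ℕ
  primeDivisorsIn m lo d = filter (primeDivisor? m) (interval lo d)

  primeDivisorsIn-sound : ∀ m lo d →
    All (λ p → (lo < p × p ≤ lo + d) × PrimeDivisor m p) (primeDivisorsIn m lo d)
  primeDivisorsIn-sound m lo d = All.zip
    (All-filter⁺ (primeDivisor? m) (interval-bounds lo d) ,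
     all-filter (primeDivisor? m) (interval lo d))

  primeDivisorsIn-primes : ∀ m lo d → All Prime (primeDivisorsIn m lo d)
  primeDivisorsIn-primes m lo d = All.map (proj₁ ∘ proj₂) (primeDivisorsIn-sound m lo d)

  primeDivisorsIn-++ : ∀ m lo d e →
    primeDivisorsIn m lo (e + d) ≡ primeDivisorsIn m (lo + d) e ++ primeDivisorsIn m lo d
  primeDivisorsIn-++ m lo d e = trans (cong (filter (primeDivisor? m)) (interval-++ lo d e))
    (filter-++ (primeDivisor? m) (interval (lo + d) e) (interval lo d))

  primeDivisorsIn-none : ∀ m lo d → (∀ {p} → lo < p → p ≤ lo + d → ¬ PrimeDivisor m p) →
                         primeDivisorsIn m lo d ≡ []
  primeDivisorsIn-none m lo d none = filter-none (primeDivisor? m)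
    (All.map (λ (lo<p , p≤lo+d) → none lo<p p≤lo+d) (interval-bounds lo d))

  [1+lo]^length≤ : ∀ m lo d {n} .{{_ : NonZero n}} →
    (∀ {p} → lo < p → p ≤ lo + d → PrimeDivisor m p → p ∣ n) →
    suc lo ^ length (primeDivisorsIn m lo d) ≤ n
  [1+lo]^length≤ m lo d divides-n = ≤-trans
    ([1+x]^length≤product (All.map (proj₁ ∘ proj₁) (primeDivisorsIn-sound m lo d)))
    (∣⇒≤ (product∣ (AllPairs-filter⁺ (primeDivisor? m) (interval-decreasing lo d))
                   (primeDivisorsIn-primes m lo d)
                   (All.map (λ ((lo<p , p≤lo+d) , pd) → divides-n lo<p p≤lo+d pd)
                            (primeDivisorsIn-sound m lo d))))

  m^n≤m^o⇒n≤o : ∀ m {n o} → 1 < m → m ^ n ≤ m ^ o → n ≤ o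
  m^n≤m^o⇒n≤o m 1<m mⁿ≤mᵒ = ≮⇒≥ (λ o<n → <⇒≱ (^-monoʳ-< m 1<m o<n) mⁿ≤mᵒ)

  -- At most x/(2s) primes of (x, 2x] can divide m once 16^s ≤ x + 1, since their product
  -- divides the central binomial coefficient, which is at most 4^x.
  dyadicBlock : ∀ m x s .{{_ : NonZero x}} .{{_ : NonZero s}} → 2 ^ (4 * s) ≤ suc x →
                Hʳ (primeDivisorsIn m x x) ≤ʳ suc s ÷ s
  dyadicBlock m x s 2^4s≤1+x = ≤ʳ-trans
    (Hʳ≤1+2length/x (All.map (proj₁ ∘ proj₁) (primeDivisorsIn-sound m x x)) 2c≤x)
    ([x+a]/x≤[1+w]/w 2cs≤x)
    where
    open ≤-Reasoning
    c = length (primeDivisorsIn m x x)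
    4sc≤2x : 4 * s * c ≤ x + x
    4sc≤2x = m^n≤m^o⇒n≤o 2 (s≤s (s≤s z≤n)) (begin
      2 ^ (4 * s * c)   ≡⟨ ^-*-assoc 2 (4 * s) c ⟨
      (2 ^ (4 * s)) ^ c ≤⟨ ^-monoˡ-≤ c 2^4s≤1+x ⟩
      suc x ^ c         ≤⟨ [1+lo]^length≤ m x x {{nCk≢0 (m≤m+n x x)}}
                             (λ x<p p≤2x (pp , _) → prime∣[2x]Cx pp x<p p≤2x) ⟩
      (x + x) C x       ≤⟨ nCk≤2^n (x + x) x ⟩
      2 ^ (x + x)       ∎)
    2cs≤x : 2 * c * s ≤ x
    2cs≤x = *-cancelˡ-≤ 2 (subst₂ _≤_ (4sc≡2[2cs] s c) (x+x≡2x x) 4sc≤2x)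
      where
      4sc≡2[2cs] : ∀ s c → 4 * s * c ≡ 2 * (2 * c * s)
      4sc≡2[2cs] = solve-∀
      x+x≡2x : ∀ x → x + x ≡ 2 * x
      x+x≡2x = solve-∀
    2c≤x : 2 * c ≤ x
    2c≤x = ≤-trans (m≤m*n (2 * c) s) 2cs≤x

  dyadicChain : ∀ m n s j .{{_ : NonZero n}} .{{_ : NonZero s}} → 2 ^ (4 * s) ≤ suc n →
                (∀ {p} → p ≤ n → ¬ PrimeDivisor m p) →
                Hʳ (primeDivisorsIn m 0 (2 ^ j * n)) ≤ʳ suc s ^ j ÷ s ^ j
  dyadicChain m n s zero    _        rough = subst (λ ps → Hʳ ps ≤ʳ 1 ÷ 1)
    (sym (primeDivisorsIn-none m 0 (1 * n)
           (λ _ p≤1*n → rough (≤-trans p≤1*n (≤-reflexive (*-identityˡ n))))))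
    (*≤* ≤-refl)
  dyadicChain m n s (suc j) 2^4s≤1+n rough = subst (_≤ʳ suc s ^ suc j ÷ s ^ suc j) (sym split)
    (*ʳ-mono-≤ʳ (dyadicBlock m x s {{x≢0}} 2^4s≤1+x) (dyadicChain m n s j 2^4s≤1+n rough))
    where
    open ≡-Reasoning
    x = 2 ^ j * n
    x≢0 : NonZero x
    x≢0 = m*n≢0 (2 ^ j) n {{m^n≢0 2 j}}
    2^4s≤1+x : 2 ^ (4 * s) ≤ suc x
    2^4s≤1+x = ≤-trans 2^4s≤1+n (s≤s (m≤n*m n (2 ^ j) {{m^n≢0 2 j}}))
    split : Hʳ (primeDivisorsIn m 0 (2 ^ suc j * n)) ≡
            Hʳ (primeDivisorsIn m x x) *ʳ Hʳ (primeDivisorsIn m 0 x)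
    split = begin
      Hʳ (primeDivisorsIn m 0 (2 ^ suc j * n))            ≡⟨ cong (Hʳ ∘ primeDivisorsIn m 0) 2^[1+j]n≡x+x ⟩
      Hʳ (primeDivisorsIn m 0 (x + x))                    ≡⟨ cong Hʳ (primeDivisorsIn-++ m 0 x x) ⟩
      Hʳ (primeDivisorsIn m x x ++ primeDivisorsIn m 0 x) ≡⟨ Hʳ-++ (primeDivisorsIn m x x) _ ⟩
      Hʳ (primeDivisorsIn m x x) *ʳ Hʳ (primeDivisorsIn m 0 x) ∎
      where
      2^[1+j]n≡x+x : 2 ^ suc j * n ≡ x + x
      2^[1+j]n≡x+x = trans (*-assoc 2 (2 ^ j) n) (cong (x +_) (+-identityʳ x))

  tailBound : ∀ m X k .{{_ : NonZero m}} .{{_ : NonZero X}} → m ≤ suc X ^ k → 2 * k ≤ X →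
              Hʳ (primeDivisorsIn m X m) ≤ʳ X + 2 * k ÷ X
  tailBound m X k m≤[1+X]^k 2k≤X = ≤ʳ-trans
    (Hʳ≤1+2length/x (All.map (proj₁ ∘ proj₁) (primeDivisorsIn-sound m X m)) (≤-trans 2c≤2k 2k≤X))
    (*≤* (begin
      (X + 2 * c) * X ≡⟨ *-comm (X + 2 * c) X ⟩
      X * (X + 2 * c) ≤⟨ *-monoʳ-≤ X (+-monoʳ-≤ X 2c≤2k) ⟩
      X * (X + 2 * k) ∎))
    where
    open ≤-Reasoning
    c = length (primeDivisorsIn m X m)
    2c≤2k : 2 * c ≤ 2 * k
    2c≤2k = *-monoʳ-≤ 2 (m^n≤m^o⇒n≤o (suc X) {c} {k} (s≤s (>-nonZero⁻¹ X))
      (≤-trans ([1+lo]^length≤ m X m (λ _ _ (_ , p∣m) → p∣m)) m≤[1+X]^k))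

  primeDivisors : ℕ → List ℕ
  primeDivisors m = primeDivisorsIn m 0 m

  primeDivisors-split : ∀ m X .{{_ : NonZero m}} →
                        primeDivisors m ≡ primeDivisorsIn m X m ++ primeDivisorsIn m 0 X
  primeDivisors-split m X = begin
    primeDivisorsIn m 0 m                          ≡⟨ cong (_++ primeDivisorsIn m 0 m) beyond-m ⟨
    primeDivisorsIn m m X ++ primeDivisorsIn m 0 m ≡⟨ primeDivisorsIn-++ m 0 m X ⟨
    primeDivisorsIn m 0 (X + m)                    ≡⟨ cong (primeDivisorsIn m 0) (+-comm X m) ⟩
    primeDivisorsIn m 0 (m + X)                    ≡⟨ primeDivisorsIn-++ m 0 X m ⟩
    primeDivisorsIn m X m ++ primeDivisorsIn m 0 X ∎
    where
    open ≡-Reasoning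
    beyond-m : primeDivisorsIn m m X ≡ []
    beyond-m = primeDivisorsIn-none m m X (λ m<p _ (_ , p∣m) → <⇒≱ m<p (∣⇒≤ p∣m))

  n<2^n : ∀ n → n < 2 ^ n
  n<2^n zero    = z<s
  n<2^n (suc n) = begin-strict
    suc n         <⟨ s≤s (n<2^n n) ⟩
    1 + 2 ^ n     ≤⟨ +-monoˡ-≤ (2 ^ n) (m^n>0 2 n) ⟩
    2 ^ n + 2 ^ n ≡⟨ cong (2 ^ n +_) (+-identityʳ (2 ^ n)) ⟨
    2 ^ suc n     ∎
    where open ≤-Reasoning

  Hʳ-primeDivisors≤[1+1/w]² : ∀ {n m s w J} .{{_ : NonZero s}} .{{_ : NonZero w}} →
    2 * J * w ≤ s → 4 * w ≤ 2 ^ J → 2 ^ (4 * s) ≤ n → m ≤ suc n ^ suc n →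
    (∀ {p} → p ≤ n → ¬ PrimeDivisor m p) →
    Hʳ (primeDivisors m) ≤ʳ suc w * suc w ÷ w * w
  Hʳ-primeDivisors≤[1+1/w]² {n} {m} {s} {w} {J} 2Jw≤s 4w≤2^J 2^4s≤n m≤[1+n]^[1+n] rough =
    subst (_≤ʳ suc w * suc w ÷ w * w)
          (sym (trans (cong Hʳ (primeDivisors-split m X)) (Hʳ-++ (primeDivisorsIn m X m) _)))
          (*ʳ-mono-≤ʳ aboveX belowX)
    where
    open ≤-Reasoning
    instance
      n≢0 : NonZero n
      n≢0 = >-nonZero (≤-trans (m^n>0 2 (4 * s)) 2^4s≤n)
      m≢0 : NonZero m
      m≢0 = ≢-nonZero λ { refl → rough 2≤n (prime[2] , 2 ∣0) }
        where
        2≤n : 2 ≤ n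
        2≤n = ≤-trans (^-monoʳ-≤ 2 (>-nonZero⁻¹ (4 * s) {{m*n≢0 4 s}})) 2^4s≤n
    X = 2 ^ J * n
    n≤X : n ≤ X
    n≤X = m≤n*m n (2 ^ J) {{m^n≢0 2 J}}
    instance
      X≢0 : NonZero X
      X≢0 = >-nonZero (≤-trans (>-nonZero⁻¹ n) n≤X)
    2[1+n]w≤X : 2 * suc n * w ≤ X
    2[1+n]w≤X = begin
      2 * (1 + n) * w ≤⟨ *-monoˡ-≤ w (*-monoʳ-≤ 2 (+-monoˡ-≤ n (>-nonZero⁻¹ n))) ⟩
      2 * (n + n) * w ≡⟨ 2[n+n]w≡4wn n w ⟩
      4 * w * n       ≤⟨ *-monoˡ-≤ n 4w≤2^J ⟩
      X               ∎
      where
      2[n+n]w≡4wn : ∀ n w → 2 * (n + n) * w ≡ 4 * w * n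
      2[n+n]w≡4wn = solve-∀
    belowX : Hʳ (primeDivisorsIn m 0 X) ≤ʳ suc w ÷ w
    belowX = ≤ʳ-trans {{m^n≢0 s J}} (dyadicChain m n s J (m≤n⇒m≤1+n 2^4s≤n) rough)
      (≤ʳ-trans ([1+1/x]^c≤1+2c/x s J (≤-trans (m≤m*n (2 * J) w) 2Jw≤s)) ([x+a]/x≤[1+w]/w 2Jw≤s))
    aboveX : Hʳ (primeDivisorsIn m X m) ≤ʳ suc w ÷ w
    aboveX = ≤ʳ-trans
      (tailBound m X (suc n) m≤[1+X]^[1+n] (≤-trans (m≤m*n (2 * suc n) w) 2[1+n]w≤X))
      ([x+a]/x≤[1+w]/w 2[1+n]w≤X)
      where
      m≤[1+X]^[1+n] : m ≤ suc X ^ suc n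
      m≤[1+X]^[1+n] = ≤-trans m≤[1+n]^[1+n] (^-monoˡ-≤ (suc n) (s≤s n≤X))

  -- The threshold 2 ^ (4 * s) must never be evaluated (it is huge in unary), hence the explicit
  -- implicit arguments here and Product.map rather than pattern matching on the pair below.
  Hʳ-primeDivisors<1+1/V : ∀ V → ∃ λ N → ∀ {n m} → N ≤ n → m ≤ suc n ^ suc n →
                           (∀ {p} → p ≤ n → ¬ PrimeDivisor m p) →
                           Hʳ (primeDivisors m) <ʳ suc V ÷ V
  Hʳ-primeDivisors<1+1/V V = 2 ^ (4 * s) , λ {n} {m} 2^4s≤n m≤[1+n]^[1+n] rough →
    ≤ʳ-<ʳ-trans {{Hʳ-denominator≢0 (primeDivisorsIn-primes m 0 m)}}
      (Hʳ-primeDivisors≤[1+1/w]² {n} {m} {s} {w} {J}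
        ≤-refl (<⇒≤ (n<2^n J)) 2^4s≤n m≤[1+n]^[1+n] rough)
      (*<* (subst (suc w * suc w * V <_) (sym (w²[1+V]≡[1+w]²V+1+V V)) (m<m+n _ z<s)))
    where
    w = suc (2 * V)
    J = 4 * w
    s = 2 * J * w
    instance
      s≢0 : NonZero s
      s≢0 = m*n≢0 (2 * J) w {{m*n≢0 2 J {{_}} {{m*n≢0 4 w}}}}
    w²[1+V]≡[1+w]²V+1+V : ∀ V → let w = suc (2 * V) in w * w * suc V ≡ suc w * suc w * V + suc V
    w²[1+V]≡[1+w]²V+1+V = solve-∀

  n!≤n^n : ∀ n → n ! ≤ n ^ n
  n!≤n^n zero    = ≤-refl
  n!≤n^n (suc n) = *-monoʳ-≤ (suc n) (≤-trans (n!≤n^n n) (^-monoˡ-≤ n (n≤1+n n)))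

  m<n≤o⇒m*n∣o! : ∀ {m n o} .{{_ : NonZero m}} → m < n → n ≤ o → m * n ∣ o !
  m<n≤o⇒m*n∣o! {m} {suc n} (s≤s m≤n) 1+n≤o = ∣-trans
    (subst (m * suc n ∣_) (*-comm (n !) (suc n)) (*-pres-∣ (m≤n⇒m∣n! m≤n) (∣-refl {suc n})))
    (m≤n⇒m!∣n! 1+n≤o)

  -- Every prime p ≤ n divides a n!/b once 2b ≤ n: p b divides n! (with 2b in place of b if p ≤ b).
  prime≤n⇒p∣a*n!/b : ∀ {a b n p} .{{_ : NonZero b}} → b ∣ a * n ! → 2 * b ≤ n → Prime p → p ≤ n →
                     p ∣ a * n ! / b
  prime≤n⇒p∣a*n!/b {a} {b} {n} {p} b∣a*n! 2b≤n pp p≤n =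
    *-cancelʳ-∣ b (subst (p * b ∣_) (sym (m/n*n≡m b∣a*n!)) (∣n⇒∣m*n a p*b∣n!))
    where
    instance
      p≢0 : NonZero p
      p≢0 = prime⇒nonZero pp
    p*b∣n! : p * b ∣ n !
    p*b∣n! with p ≤? b
    ... | yes p≤b = ∣-trans (*-monoʳ-∣ p (n∣m*n 2)) (m<n≤o⇒m*n∣o! (≤-<-trans p≤b b<2b) 2b≤n)
      where
      b<2b : b < 2 * b
      b<2b = subst (b <_) (*-comm b 2) (m<m*n b 2 (s≤s (s≤s z≤n)))
    ... | no  p≰b = subst (_∣ n !) (*-comm b p) (m<n≤o⇒m*n∣o! (≰⇒> p≰b) p≤n)

  p/d<1+1/v⇒[p∸d]/d<[1+u]/v : ∀ {p d v} u → d ≤ p → p ÷ d <ʳ suc v ÷ v → p ∸ d ÷ d <ʳ suc u ÷ v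
  p/d<1+1/v⇒[p∸d]/d<[1+u]/v {p} {d} {v} u d≤p (*<* pv<d[1+v]) =
    *<* (≤-trans (+-cancelʳ-< (d * v) ((p ∸ d) * v) d (begin-strict
      (p ∸ d) * v + d * v ≡⟨ *-distribʳ-+ v (p ∸ d) d ⟨
      (p ∸ d + d) * v     ≡⟨ cong (_* v) (m∸n+n≡m d≤p) ⟩
      p * v               <⟨ pv<d[1+v] ⟩
      d * suc v           ≡⟨ *-suc d v ⟩
      d + d * v           ∎))
    (m≤m*n d (suc u)))
    where open ≤-Reasoning

  p∣m⇒p∤m+1 : ∀ {p m} → Prime p → p ∣ m → p ∤ m + 1
  p∣m⇒p∤m+1 pp p∣m p∣m+1 = prime∤1 pp (∣m+n∣m⇒∣n p∣m+1 p∣m)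

  p∣m⇒p∤m∸1 : ∀ {p m} .{{_ : NonZero m}} → Prime p → p ∣ m → p ∤ m ∸ 1
  p∣m⇒p∤m∸1 {p} {suc m} pp p∣1+m p∣m = p∣m⇒p∤m+1 pp p∣m (subst (p ∣_) (+-comm 1 m) p∣1+m)

  Hʳ-primeDivisors[g[a*n!/b]]<1+1/V : ∀ a b .{{_ : NonZero a}} .{{_ : NonZero b}} (g : ℕ → ℕ) →
    (∀ M → g M ≤ suc M) → (∀ {M p} .{{_ : NonZero M}} → Prime p → p ∣ M → p ∤ g M) →
    ∀ V → ∃ λ N → ∀ n → N ≤ n → b ∣ a * n ! → Hʳ (primeDivisors (g (a * n ! / b))) <ʳ suc V ÷ V
  Hʳ-primeDivisors[g[a*n!/b]]<1+1/V a b g g≤1+ coprime V =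
    Product.map (_+ (a + 2 * b)) bound (Hʳ-primeDivisors<1+1/V V)
    where
    gM≤[1+n]^[1+n] : ∀ n → a ≤ n → g (a * n ! / b) ≤ suc n ^ suc n
    gM≤[1+n]^[1+n] n a≤n = begin
      g (a * n ! / b)     ≤⟨ g≤1+ (a * n ! / b) ⟩
      suc (a * n ! / b)   ≤⟨ s≤s (m/n≤m (a * n !) b) ⟩
      suc (a * n !)       ≤⟨ s≤s (*-mono-≤ a≤n (n!≤n^n n)) ⟩
      suc (n * n ^ n)     ≤⟨ ^-monoˡ-< (suc n) (n<1+n n) ⟩
      suc n ^ suc n       ∎
      where open ≤-Reasoning
    rough : ∀ {n p} → b ∣ a * n ! → 2 * b ≤ n → p ≤ n → ¬ PrimeDivisor (g (a * n ! / b)) p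
    rough {n} b∣a*n! 2b≤n p≤n (pp , p∣gM) =
      coprime {{M≢0}} pp (prime≤n⇒p∣a*n!/b {a} {b} {n} b∣a*n! 2b≤n pp p≤n) p∣gM
      where
      instance
        n!≢0 : NonZero (n !)
        n!≢0 = n !≢0
      M≢0 : NonZero (a * n ! / b)
      M≢0 = m*n≢0⇒m≢0 _ {{subst NonZero (sym (m/n*n≡m b∣a*n!)) (m*n≢0 a (n !))}}
    bound : ∀ {N} →
      (∀ {n m} → N ≤ n → m ≤ suc n ^ suc n → (∀ {p} → p ≤ n → ¬ PrimeDivisor m p) →
        Hʳ (primeDivisors m) <ʳ suc V ÷ V) →
      ∀ n → N + (a + 2 * b) ≤ n → b ∣ a * n ! → Hʳ (primeDivisors (g (a * n ! / b))) <ʳ suc V ÷ V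
    bound {N} H<1+1/V n N+a+2b≤n b∣a*n! = H<1+1/V (≤-trans (m≤m+n N _) N+a+2b≤n)
      (gM≤[1+n]^[1+n] n (≤-trans (≤-trans (m≤m+n a (2 * b)) (m≤n+m _ N)) N+a+2b≤n))
      (rough b∣a*n! (≤-trans (≤-trans (m≤n+m (2 * b) a) (m≤n+m _ N)) N+a+2b≤n))

open PrimeDivisorBounds

open import Defs
open import Data.Nat using (ℕ; _≥_; NonZero; _!)
open import Data.Nat.Divisibility using (_∣_)
open import Data.Nat.DivMod using (_/_)
open import Data.Product using (_×_; ∃)
open import Data.Rational using (ℚ; Positive; ∣_∣; _-_; _<_; 1ℚ)

import Data.Nat as ℕ
import Data.Nat.Properties as ℕ
open import Data.Nat.Primality using (Prime)
open import Data.Integer as ℤ using (+_)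
import Data.Integer.Properties as ℤ
open import Data.Rational as ℚ using (mkℚ; toℚᵘ)
import Data.Rational.Properties as ℚ
open import Data.Rational.Unnormalised as ℚᵘ using (ℚᵘ; mkℚᵘ; _≃_; *≡*)
import Data.Rational.Unnormalised.Properties as ℚᵘ
open import Data.List using (_∷_; map)
open import Data.Nat.ListAction using (product)
open import Data.Product using (_,_)
import Data.Product as Product
open import Relation.Nullary using (¬_; yes; no)
open import Relation.Nullary.Decidable using (dec-true; dec-false)
open import Data.Bool using (if_then_else_)
open import Data.List.Properties using (filter-accept; filter-reject)
open import Relation.Binary.PropositionalEquality using (_≡_; sym; trans; cong; cong₂; subst; subst₂)
open import Function using (_∘_)

-- A zero denominator is read as 1.
⟦_⟧ : Ratio → ℚᵘ
⟦ p ÷ d ⟧ = mkℚᵘ (+ p) (ℕ.pred d)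

⟦⟧-*ʳ : ∀ {p d q e} .{{_ : NonZero d}} .{{_ : NonZero e}} →
        ⟦ p ÷ d *ʳ q ÷ e ⟧ ≃ ⟦ p ÷ d ⟧ ℚᵘ.* ⟦ q ÷ e ⟧
⟦⟧-*ʳ {p} {ℕ.suc d} {q} {ℕ.suc e} = *≡* (cong (ℤ._* + (ℕ.suc d ℕ.* ℕ.suc e)) (ℤ.pos-* p q))

⟦⟧-mono-< : ∀ {p d q e} .{{_ : NonZero d}} .{{_ : NonZero e}} →
            p ÷ d <ʳ q ÷ e → ⟦ p ÷ d ⟧ ℚᵘ.< ⟦ q ÷ e ⟧
⟦⟧-mono-< {p} {ℕ.suc d} {q} {ℕ.suc e} (*<* pe<dq) =
  ℚᵘ.*<* (subst₂ ℤ._<_ (ℤ.pos-* p (ℕ.suc e)) (ℤ.pos-* q (ℕ.suc d))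
    (ℤ.+<+ (subst (p ℕ.* ℕ.suc e ℕ.<_) (ℕ.*-comm (ℕ.suc d) q) pe<dq)))

∣⟦⟧-1∣≃ : ∀ {p d} .{{_ : NonZero d}} → d ℕ.≤ p → ℚᵘ.∣ ⟦ p ÷ d ⟧ ℚᵘ.- ℚᵘ.1ℚᵘ ∣ ≃ ⟦ p ℕ.∸ d ÷ d ⟧
∣⟦⟧-1∣≃ {p} {ℕ.suc d} d≤p = *≡* (cong₂ ℤ._*_ (cong (+_ ∘ ℤ.∣_∣) numerator≡)
                                               (cong +_ (sym (ℕ.*-identityʳ (ℕ.suc d)))))
  where
  numerator≡ : + p ℤ.* + 1 ℤ.+ ℤ.-1ℤ ℤ.* + ℕ.suc d ≡ + (p ℕ.∸ ℕ.suc d)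
  numerator≡ = trans (cong₂ ℤ._+_ (ℤ.*-identityʳ (+ p)) (ℤ.-1*i≡-i (+ ℕ.suc d)))
                     (trans (ℤ.m-n≡m⊖n p (ℕ.suc d)) (ℤ.⊖-≥ d≤p))

ratio≃⟦p/[p-1]⟧ : ∀ {p} → Prime p → toℚᵘ (ratio p) ≃ ⟦ p ÷ ℕ.pred p ⟧
ratio≃⟦p/[p-1]⟧ {ℕ.suc (ℕ.suc k)} _ = ℚ.toℚᵘ-fromℚᵘ (mkℚᵘ (+ ℕ.suc (ℕ.suc k)) k)

Hupto-accept : ∀ {m K} → PrimeDivisor m (ℕ.suc K) → Hupto m (ℕ.suc K) ≡ Hupto m K ℚ.* ratio (ℕ.suc K)
Hupto-accept {m} {K} pd = cong (λ b → Hupto m K ℚ.* (if b then ratio (ℕ.suc K) else 1ℚ))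
                               (dec-true (primeDivisor? m (ℕ.suc K)) pd)

Hupto-reject : ∀ {m K} → ¬ PrimeDivisor m (ℕ.suc K) → Hupto m (ℕ.suc K) ≡ Hupto m K
Hupto-reject {m} {K} ¬pd = trans (cong (λ b → Hupto m K ℚ.* (if b then ratio (ℕ.suc K) else 1ℚ))
                                       (dec-false (primeDivisor? m (ℕ.suc K)) ¬pd))
                                 (ℚ.*-identityʳ (Hupto m K))

Hupto≃⟦Hʳ⟧ : ∀ m K → toℚᵘ (Hupto m K) ≃ ⟦ Hʳ (primeDivisorsIn m 0 K) ⟧
Hupto≃⟦Hʳ⟧ m ℕ.zero    = ℚᵘ.≃-refl
Hupto≃⟦Hʳ⟧ m (ℕ.suc K) with primeDivisor? m (ℕ.suc K)
... | no ¬pd = begin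
  toℚᵘ (Hupto m (ℕ.suc K))               ≡⟨ cong toℚᵘ (Hupto-reject ¬pd) ⟩
  toℚᵘ (Hupto m K)                       ≈⟨ Hupto≃⟦Hʳ⟧ m K ⟩
  ⟦ Hʳ (primeDivisorsIn m 0 K) ⟧         ≡⟨ cong (⟦_⟧ ∘ Hʳ) (filter-reject (primeDivisor? m) ¬pd) ⟨
  ⟦ Hʳ (primeDivisorsIn m 0 (ℕ.suc K)) ⟧ ∎
  where open ℚᵘ.≃-Reasoning
... | yes pd@(pp , _) = begin
  toℚᵘ (Hupto m (ℕ.suc K))                     ≡⟨ cong toℚᵘ (Hupto-accept pd) ⟩
  toℚᵘ (Hupto m K ℚ.* ratio (ℕ.suc K))         ≈⟨ ℚ.toℚᵘ-homo-* (Hupto m K) (ratio (ℕ.suc K)) ⟩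
  toℚᵘ (Hupto m K) ℚᵘ.* toℚᵘ (ratio (ℕ.suc K)) ≈⟨ ℚᵘ.*-cong (Hupto≃⟦Hʳ⟧ m K) (ratio≃⟦p/[p-1]⟧ pp) ⟩
  ⟦ Hʳ ps ⟧ ℚᵘ.* ⟦ ℕ.suc K ÷ K ⟧               ≈⟨ ℚᵘ.*-comm ⟦ Hʳ ps ⟧ _ ⟩
  ⟦ ℕ.suc K ÷ K ⟧ ℚᵘ.* ⟦ Hʳ ps ⟧               ≈⟨ ⟦⟧-*ʳ {ℕ.suc K} {K} ⟨
  ⟦ Hʳ (ℕ.suc K ∷ ps) ⟧                        ≡⟨ cong (⟦_⟧ ∘ Hʳ) (filter-accept (primeDivisor? m) pd) ⟨
  ⟦ Hʳ (primeDivisorsIn m 0 (ℕ.suc K)) ⟧       ∎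
  where
  open ℚᵘ.≃-Reasoning
  ps = primeDivisorsIn m 0 K
  instance
    K≢0 : NonZero K
    K≢0 = prime⇒pred≢0 pp
    D≢0 : NonZero (product (map ℕ.pred ps))
    D≢0 = Hʳ-denominator≢0 (primeDivisorsIn-primes m 0 K)

toℚᵘ∣H-1∣< : ∀ m {u v} → Hʳ (primeDivisors m) <ʳ ℕ.suc (ℕ.suc v) ÷ ℕ.suc v →
             toℚᵘ ∣ H m - 1ℚ ∣ ℚᵘ.< mkℚᵘ (+ ℕ.suc u) v
toℚᵘ∣H-1∣< m {u} {v} H<1+1/v = begin-strict
  toℚᵘ ∣ H m - 1ℚ ∣                    ≃⟨ ℚ.toℚᵘ-homo-∣-∣ (H m - 1ℚ) ⟩
  ℚᵘ.∣ toℚᵘ (H m - 1ℚ) ∣               ≃⟨ ℚᵘ.∣-∣-cong (ℚᵘ.≃-trans (ℚ.toℚᵘ-homo-+ (H m) (ℚ.- 1ℚ))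
                                                        (ℚᵘ.+-congˡ (toℚᵘ (ℚ.- 1ℚ)) (Hupto≃⟦Hʳ⟧ m m))) ⟩
  ℚᵘ.∣ ⟦ Hʳ ps ⟧ ℚᵘ.- ℚᵘ.1ℚᵘ ∣          ≃⟨ ∣⟦⟧-1∣≃ (Hʳ-denominator≤numerator ps) ⟩
  ⟦ product ps ℕ.∸ D ÷ D ⟧             <⟨ ⟦⟧-mono-< (p/d<1+1/v⇒[p∸d]/d<[1+u]/v u
                                                     (Hʳ-denominator≤numerator ps) H<1+1/v) ⟩
  mkℚᵘ (+ ℕ.suc u) v                   ∎
  where
  open ℚᵘ.≤-Reasoning
  ps = primeDivisors m
  D = product (map ℕ.pred ps)
  instance
    D≢0 : NonZero D
    D≢0 = Hʳ-denominator≢0 (primeDivisorsIn-primes m 0 m)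

∣H[g[a*n!/b]]-1∣→0 : (a b : ℕ) → .{{_ : NonZero a}} → .{{_ : NonZero b}} → (g : ℕ → ℕ) →
  (∀ M → g M ℕ.≤ ℕ.suc M) → (∀ {M p} .{{_ : NonZero M}} → Prime p → p ∣ M → ¬ p ∣ g M) →
  ∀ (ε : ℚ) → Positive ε → ∃ λ N → ∀ n → n ≥ N → b ∣ a ℕ.* (n !) →
    ∣ H (g ((a ℕ.* (n !)) / b)) - 1ℚ ∣ < ε
∣H[g[a*n!/b]]-1∣→0 a b g g≤1+ coprime (mkℚ (+ ℕ.zero) _ _) ()
∣H[g[a*n!/b]]-1∣→0 a b g g≤1+ coprime (mkℚ ℤ.-[1+ _ ] _ _) ()
∣H[g[a*n!/b]]-1∣→0 a b g g≤1+ coprime (mkℚ (+ ℕ.suc u) v _) _ =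
  Product.map₂ (λ H<1+1/v n n≥N b∣a*n! →
                 ℚ.toℚᵘ-cancel-< (toℚᵘ∣H-1∣< (g (a ℕ.* n ! / b)) (H<1+1/v n n≥N b∣a*n!)))
               (Hʳ-primeDivisors[g[a*n!/b]]<1+1/V a b g g≤1+ coprime (ℕ.suc v))

theorem9 : (a b : ℕ) → .{{_ : NonZero a}} → .{{_ : NonZero b}} →
    (∀ (ε : ℚ) → Positive ε → ∃ λ N → ∀ n → n ≥ N → b ∣ a Data.Nat.* (n !) →
      ∣ H ((a Data.Nat.* (n !)) / b Data.Nat.+ 1) - 1ℚ ∣ < ε)
    × (∀ (ε : ℚ) → Positive ε → ∃ λ N → ∀ n → n ≥ N → b ∣ a Data.Nat.* (n !) →
      ∣ H ((a Data.Nat.* (n !)) / b Data.Nat.∸ 1) - 1ℚ ∣ < ε)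
theorem9 a b =
  ∣H[g[a*n!/b]]-1∣→0 a b (ℕ._+ 1) (λ M → ℕ.≤-reflexive (ℕ.+-comm M 1)) p∣m⇒p∤m+1 ,
  ∣H[g[a*n!/b]]-1∣→0 a b (ℕ._∸ 1) (λ M → ℕ.≤-trans (ℕ.m∸n≤m M 1) (ℕ.n≤1+n M)) p∣m⇒p∤m∸1
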